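{- For all $n\ge1$, $|B_n(\bar{2}1\bar{4}3)|=|B_n(2\bar{1}\bar{4}3)|$.
   Context: $B_n$ is the set of signed permutations of $[n]$, written as words $\pi=\pi_1\cdots\pi_n$ in which each of $1,\dots,n$ appears exactly once, possibly barred (negative, written $\bar{a}$). A signed permutation $\pi\in B_n$ contains $\tau\in B_k$ if there are indices $i_1<\dots<i_k$ such that for all $a,b$: $|\pi_{i_a}|<|\pi_{i_b}|$ iff $|\tau_a|<|\tau_b|$, and $\pi_{i_a}$ is positive iff $\tau_a$ is positive; otherwise $\pi$ avoids $\tau$. $B_n(\tau)$ is the set of elements of $B_n$ avoiding $\tau$. -}

module Defs where

open import Data.Nat using (ℕ)
open import Data.Bool using (Bool; true; false)
open import Data.Fin using (Fin; zero; suc; _<_)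
open import Data.Product using (_×_; _,_; proj₁; proj₂; Σ; ∃)
open import Data.Vec using (Vec; lookup; []; _∷_)
open import Function using (_⇔_)
open import Relation.Binary.PropositionalEquality using (_≡_)
open import Relation.Nullary using (¬_)

-- A signed letter: (sign , absolute value). sign = true means positive,
-- false means barred (negative). Absolute values 1..n are encoded 0-based
-- as Fin n (value v ∈ Fin n stands for the integer toℕ v + 1).
Letter : ℕ → Set
Letter n = Bool × Fin n

Word : ℕ → Set
Word n = Vec (Letter n) n

sign : ∀ {n} → Letter n → Bool
sign = proj₁

absv : ∀ {n} → Letter n → Fin n
absv = proj₂

IsSignedPerm : ∀ {n} → Word n → Set
IsSignedPerm {n} w =
  (∀ (v : Fin n) → ∃ λ i → absv (lookup w i) ≡ v) ×
  (∀ (i j : Fin n) → absv (lookup w i) ≡ absv (lookup w j) → i ≡ j)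

Contains : ∀ {n k} → Word n → Word k → Set
Contains {n} {k} π τ =
  Σ (Fin k → Fin n) λ ι →
    (∀ a b → a < b → ι a < ι b) ×
    (∀ a b → (absv (lookup π (ι a)) < absv (lookup π (ι b))) ⇔ (absv (lookup τ a) < absv (lookup τ b))) ×
    (∀ a → sign (lookup π (ι a)) ≡ sign (lookup τ a))

Avoids : ∀ {n k} → Word n → Word k → Set
Avoids π τ = ¬ Contains π τ

InB : ∀ {k} (n : ℕ) → Word k → Word n → Set
InB n τ w = IsSignedPerm w × Avoids w τ

SameCard : ∀ {n} → (Word n → Set) → (Word n → Set) → Set
SameCard {n} P Q =
  Σ (Word n → Word n) λ f → Σ (Word n → Word n) λ g →
    (∀ w → P w → Q (f w)) ×
    (∀ w → Q w → P (g w)) ×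
    (∀ w → P w → g (f w) ≡ w) ×
    (∀ w → Q w → f (g w) ≡ w)

-- Patterns, written with 0-based absolute values.
-- 2̄ 1 4̄ 3
τ₁ : Word 4
τ₁ = (false , suc zero) ∷ (true , zero) ∷ (false , suc (suc (suc zero))) ∷ (true , suc (suc zero)) ∷ []

-- 2 1̄ 4̄ 3
τ₂ : Word 4
τ₂ = (true , suc zero) ∷ (false , zero) ∷ (false , suc (suc (suc zero))) ∷ (true , suc (suc zero)) ∷ []

{-# OPTIONS --safe #-}
-- Call an entry e of w marked if it is the x of an occurrence x 4̄ 3 (positions e < k < l, the 4̄
-- barred, the 3 positive, |x| < 3 < 4). Flipping the signs of all marked entries is an involution:
-- the pair (4̄, 3) can always be moved right until its own entries are unmarked, so the flip does
-- not change which entries are marked. In an occurrence of 2̄14̄3 or 21̄4̄3 the entries 2 and 1 are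
-- marked; moving the 4̄3 to unmarked entries, the flip turns it into an occurrence of the other
-- pattern. Hence the involution exchanges the two avoidance classes.
module Submission where

open import Defs
open import Data.Nat using (ℕ; suc; z<s; s<s)
import Data.Nat.Properties as ℕ
open import Data.Bool using (Bool; true; false; not; _xor_)
open import Data.Bool.Properties using (not-involutive) renaming (_≟_ to _≟ᵇ_)
open import Data.Fin using (Fin; zero; suc; #_; inject₁; _<_; _>_; _≤_; _<?_)
open import Data.Fin.Properties using (any?; <-trans; <-cmp; <-irrefl; <-asym)
open import Data.Fin.Induction using (>-wellFounded)
open import Induction.WellFounded using (Acc; acc)
open import Data.Product using (_×_; _,_; ∃₂; map₂)
open import Data.Vec using (lookup; tabulate; []; _∷_)
open import Data.Vec.Properties using (lookup∘tabulate; tabulate∘lookup; tabulate-cong)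
open import Function using (_∘_; _⇔_; mk⇔; Equivalence)
open import Relation.Binary.Core using (_Preserves_⟶_)
open import Relation.Binary.Definitions using (tri<; tri≈; tri>)
open import Relation.Binary.PropositionalEquality
  using (_≡_; refl; sym; trans; cong; cong₂; subst; subst₂; module ≡-Reasoning)
open import Relation.Nullary using (¬_; Dec; yes; no; does; contradiction)
open import Relation.Nullary.Decidable using (_×-dec_; map′; dec-true; dec-false)

private
  variable
    k n : ℕ

steps⇒increasing : (f : Fin (suc k) → Fin n) → (∀ a → f (inject₁ a) < f (suc a)) →
                   f Preserves _<_ ⟶ _<_
steps⇒increasing {k = suc _} f step {zero}  {suc zero}    _          = step zero
steps⇒increasing {k = suc _} f step {zero}  {suc (suc b)} _          =
  <-trans (step zero) (steps⇒increasing (f ∘ suc) (step ∘ suc) {zero} {suc b} z<s)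
steps⇒increasing {k = suc _} f step {suc a} {suc b}       (s<s a<b) =
  steps⇒increasing (f ∘ suc) (step ∘ suc) a<b

increasing⇒reflects : {f : Fin k → Fin n} {a b : Fin k} → f Preserves _<_ ⟶ _<_ →
                      f a < f b → a < b
increasing⇒reflects {a = a} {b} mono fa<fb with <-cmp a b
... | tri< a<b _ _ = a<b
... | tri≈ _ refl _ = contradiction fa<fb (<-irrefl refl)
... | tri> _ _ b<a = contradiction fa<fb (<-asym (mono b<a))

embedding⇒Contains : {π : Word n} {τ : Word k} (ι g : Fin k → Fin n) →
                     ι Preserves _<_ ⟶ _<_ → g Preserves _<_ ⟶ _<_ →
                     (∀ a → absv (lookup π (ι a)) ≡ g (absv (lookup τ a))) →
                     (∀ a → sign (lookup π (ι a)) ≡ sign (lookup τ a)) →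
                     Contains π τ
embedding⇒Contains {π = π} {τ} ι g ι-mono g-mono absv-eq sign-eq =
  ι , (λ _ _ → ι-mono) , order-iso , sign-eq
  where
  order-iso : ∀ a b → (absv (lookup π (ι a)) < absv (lookup π (ι b))) ⇔
                      (absv (lookup τ a) < absv (lookup τ b))
  order-iso a b rewrite absv-eq a | absv-eq b = mk⇔ (increasing⇒reflects g-mono) g-mono

IsSignedPerm-resp-absv : {w w′ : Word n} → (∀ i → absv (lookup w′ i) ≡ absv (lookup w i)) →
                         IsSignedPerm w → IsSignedPerm w′
IsSignedPerm-resp-absv eq (onto , inj) =
  (λ v → map₂ (λ {i} → trans (eq i)) (onto v)) ,
  (λ i j e → inj i j (trans (sym (eq i)) (trans e (eq j))))

record Tail (w : Word n) (j v k l : Fin n) : Set where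
  constructor tail
  field
    j<k        : j < k
    k<l        : k < l
    k-barred   : sign (lookup w k) ≡ false
    l-positive : sign (lookup w l) ≡ true
    v<l        : v < absv (lookup w l)
    l<k        : absv (lookup w l) < absv (lookup w k)

tail? : ∀ (w : Word n) j v k l → Dec (Tail w j v k l)
tail? w j v k l =
  map′ (λ (a , b , c , d , e , f) → tail a b c d e f)
       (λ (tail a b c d e f) → a , b , c , d , e , f)
       ((j <? k) ×-dec (k <? l) ×-dec
        (sign (lookup w k) ≟ᵇ false) ×-dec (sign (lookup w l) ≟ᵇ true) ×-dec
        (v <? absv (lookup w l)) ×-dec (absv (lookup w l) <? absv (lookup w k)))

Tail-anti : {w : Word n} {j j′ v v′ k l : Fin n} → j′ ≤ j → v′ ≤ v →
            Tail w j v k l → Tail w j′ v′ k l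
Tail-anti j′≤j v′≤v (tail j<k k<l k-barred l-positive v<l l<k) =
  tail (ℕ.≤-<-trans j′≤j j<k) k<l k-barred l-positive (ℕ.≤-<-trans v′≤v v<l) l<k

Tail-cong : {w w′ : Word n} {j v k l : Fin n} →
            lookup w k ≡ lookup w′ k → lookup w l ≡ lookup w′ l →
            Tail w j v k l → Tail w′ j v k l
Tail-cong {v = v} eqₖ eqₗ (tail j<k k<l k-barred l-positive v<l l<k) =
  tail j<k k<l
    (trans (cong sign (sym eqₖ)) k-barred)
    (trans (cong sign (sym eqₗ)) l-positive)
    (subst (v <_) (cong absv eqₗ) v<l)
    (subst₂ _<_ (cong absv eqₗ) (cong absv eqₖ) l<k)

Marked : Word n → Fin n → Set
Marked w e = ∃₂ λ k l → Tail w e (absv (lookup w e)) k l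

marked? : ∀ (w : Word n) e → Dec (Marked w e)
marked? w e = any? λ k → any? λ l → tail? w e (absv (lookup w e)) k l

-- A rightmost choice of tail is unmarked: a tail of a tail entry lies further right and still
-- serves as a tail for (j , v).
tail⇒unmarked-tail : {w : Word n} {j v k l : Fin n} → Tail w j v k l →
                     ∃₂ λ k′ l′ → Tail w j v k′ l′ × ¬ Marked w k′ × ¬ Marked w l′
tail⇒unmarked-tail {w = w} {j} {v} {k} = go (>-wellFounded k)
  where
  go : ∀ {k l} → Acc _>_ k → Tail w j v k l →
       ∃₂ λ k′ l′ → Tail w j v k′ l′ × ¬ Marked w k′ × ¬ Marked w l′
  go {k} {l} (acc rec) t@(tail j<k k<l _ _ v<l l<k) with marked? w k | marked? w l
  ... | yes (k₂ , l₂ , tail₂) | _ =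
    go (rec (Tail.j<k tail₂)) (Tail-anti (ℕ.<⇒≤ j<k) (ℕ.<⇒≤ (<-trans v<l l<k)) tail₂)
  ... | no _ | yes (k₃ , l₃ , tail₃) =
    go (rec (<-trans k<l (Tail.j<k tail₃)))
       (Tail-anti (ℕ.<⇒≤ (<-trans j<k k<l)) (ℕ.<⇒≤ v<l) tail₃)
  ... | no k-unmarked | no l-unmarked = k , l , t , k-unmarked , l-unmarked

flipSignIf : Bool → Letter n → Letter n
flipSignIf b x = b xor sign x , absv x

flipWord : Word n → Word n
flipWord w = tabulate λ i → flipSignIf (does (marked? w i)) (lookup w i)

module _ {w : Word n} where

  absv-flipWord : ∀ i → absv (lookup (flipWord w) i) ≡ absv (lookup w i)
  absv-flipWord i = cong absv (lookup∘tabulate _ i)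

  flipWord-IsSignedPerm : IsSignedPerm w → IsSignedPerm (flipWord w)
  flipWord-IsSignedPerm = IsSignedPerm-resp-absv {w = w} {flipWord w} absv-flipWord

  lookup-flipWord-marked : ∀ {i} → Marked w i →
                           lookup (flipWord w) i ≡ flipSignIf true (lookup w i)
  lookup-flipWord-marked {i} m =
    trans (lookup∘tabulate _ i)
          (cong (λ b → flipSignIf b (lookup w i)) (dec-true (marked? w i) m))

  lookup-flipWord-unmarked : ∀ {i} → ¬ Marked w i → lookup (flipWord w) i ≡ lookup w i
  lookup-flipWord-unmarked {i} ¬m =
    trans (lookup∘tabulate _ i)
          (cong (λ b → flipSignIf b (lookup w i)) (dec-false (marked? w i) ¬m))

  sign-flipWord-marked : ∀ {i} → Marked w i →
                         sign (lookup (flipWord w) i) ≡ not (sign (lookup w i))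
  sign-flipWord-marked m = cong sign (lookup-flipWord-marked m)

  unmarked-tail-flipWord : ∀ {i j k l} → ¬ Marked w k → ¬ Marked w l →
                           Tail w j (absv (lookup w i)) k l →
                           Tail (flipWord w) j (absv (lookup (flipWord w) i)) k l
  unmarked-tail-flipWord {i} {j} {k} {l} k-unmarked l-unmarked t =
    subst (λ v → Tail (flipWord w) j v k l) (sym (absv-flipWord i))
      (Tail-cong (sym (lookup-flipWord-unmarked k-unmarked))
                 (sym (lookup-flipWord-unmarked l-unmarked)) t)

  marked⇒flipWord-marked : ∀ {e} → Marked w e → Marked (flipWord w) e
  marked⇒flipWord-marked (_ , _ , t) with tail⇒unmarked-tail t
  ... | k , l , t′ , k-unmarked , l-unmarked =
    k , l , unmarked-tail-flipWord k-unmarked l-unmarked t′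

  flipWord-marked⇒marked : ∀ {e} → Marked (flipWord w) e → Marked w e
  flipWord-marked⇒marked {e} (_ , _ , t) with tail⇒unmarked-tail t
  ... | k , l , t′ , k-unmarked , l-unmarked =
    k , l , Tail-cong (lookup-flipWord-unmarked (k-unmarked ∘ marked⇒flipWord-marked))
                      (lookup-flipWord-unmarked (l-unmarked ∘ marked⇒flipWord-marked))
                      (subst (λ v → Tail (flipWord w) e v k l) (absv-flipWord e) t′)

flipWord-involutive : (w : Word n) → flipWord (flipWord w) ≡ w
flipWord-involutive w = begin
  flipWord (flipWord w)                     ≡⟨ tabulate∘lookup _ ⟨
  tabulate (lookup (flipWord (flipWord w))) ≡⟨ tabulate-cong lookup-involutive ⟩
  tabulate (lookup w)                       ≡⟨ tabulate∘lookup w ⟩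
  w                                         ∎
  where
  open ≡-Reasoning
  lookup-involutive : ∀ i → lookup (flipWord (flipWord w)) i ≡ lookup w i
  lookup-involutive i with marked? w i
  ... | yes m = begin
    lookup (flipWord (flipWord w)) i
      ≡⟨ lookup-flipWord-marked (marked⇒flipWord-marked m) ⟩
    flipSignIf true (lookup (flipWord w) i)
      ≡⟨ cong (flipSignIf true) (lookup-flipWord-marked m) ⟩
    flipSignIf true (flipSignIf true (lookup w i))
      ≡⟨ cong (_, absv (lookup w i)) (not-involutive _) ⟩
    lookup w i
      ∎
  ... | no ¬m = trans (lookup-flipWord-unmarked (¬m ∘ flipWord-marked⇒marked))
                      (lookup-flipWord-unmarked ¬m)

pattern2143 : Bool → Bool → Word 4
pattern2143 s t = (s , # 1) ∷ (t , # 0) ∷ (false , # 3) ∷ (true , # 2) ∷ []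

contains-2143⇒tail : {w : Word n} {s t : Bool} → Contains w (pattern2143 s t) →
  ∃₂ λ i j → ∃₂ λ k l → i < j × absv (lookup w j) < absv (lookup w i) ×
    Tail w j (absv (lookup w i)) k l × sign (lookup w i) ≡ s × sign (lookup w j) ≡ t
contains-2143⇒tail (ι , ι-mono , order-iso , sign-eq) =
  ι (# 0) , ι (# 1) , ι (# 2) , ι (# 3) ,
  ι-mono _ _ z<s , Equivalence.from (order-iso (# 1) (# 0)) z<s ,
  tail (ι-mono _ _ (s<s z<s)) (ι-mono _ _ (s<s (s<s z<s))) (sign-eq (# 2)) (sign-eq (# 3))
       (Equivalence.from (order-iso (# 0) (# 3)) (s<s z<s))
       (Equivalence.from (order-iso (# 3) (# 2)) (s<s (s<s z<s))) ,
  sign-eq (# 0) , sign-eq (# 1)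

tail⇒contains-2143 : {w : Word n} {i j k l : Fin n} →
  i < j → absv (lookup w j) < absv (lookup w i) → Tail w j (absv (lookup w i)) k l →
  Contains w (pattern2143 (sign (lookup w i)) (sign (lookup w j)))
tail⇒contains-2143 {w = w} {i} {j} {k} {l} i<j wj<wi (tail j<k k<l k-barred l-positive wi<wl wl<wk) =
  embedding⇒Contains {π = w} {τ = pattern2143 _ _}
    (lookup (i ∷ j ∷ k ∷ l ∷ []))
    (lookup (absv (lookup w j) ∷ absv (lookup w i) ∷ absv (lookup w l) ∷ absv (lookup w k) ∷ []))
    (steps⇒increasing _ λ { zero → i<j ; (suc zero) → j<k ; (suc (suc zero)) → k<l })
    (steps⇒increasing _ λ { zero → wj<wi ; (suc zero) → wi<wl ; (suc (suc zero)) → wl<wk })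
    (λ { zero → refl ; (suc zero) → refl
       ; (suc (suc zero)) → refl ; (suc (suc (suc zero))) → refl })
    (λ { zero → refl ; (suc zero) → refl
       ; (suc (suc zero)) → k-barred ; (suc (suc (suc zero))) → l-positive })

flipWord-contains-2143 : {w : Word n} {s t : Bool} → Contains w (pattern2143 s t) →
                         Contains (flipWord w) (pattern2143 (not s) (not t))
flipWord-contains-2143 {w = w} occ with contains-2143⇒tail {w = w} occ
... | i , j , _ , _ , i<j , wj<wi , t , refl , refl with tail⇒unmarked-tail t
... | k , l , t′ , k-unmarked , l-unmarked =
  subst₂ (λ s t → Contains (flipWord w) (pattern2143 s t))
    (sign-flipWord-marked i-marked) (sign-flipWord-marked j-marked)
    (tail⇒contains-2143 i<j (subst₂ _<_ (sym (absv-flipWord j)) (sym (absv-flipWord i)) wj<wi)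
      (unmarked-tail-flipWord k-unmarked l-unmarked t′))
  where
  i-marked : Marked w i
  i-marked = k , l , Tail-anti (ℕ.<⇒≤ i<j) ℕ.≤-refl t′
  j-marked : Marked w j
  j-marked = k , l , Tail-anti ℕ.≤-refl (ℕ.<⇒≤ wj<wi) t′

flipWord-avoids-2143 : {w : Word n} (s t : Bool) → Avoids w (pattern2143 s t) →
                       Avoids (flipWord w) (pattern2143 (not s) (not t))
flipWord-avoids-2143 {w = w} s t avoid occ =
  avoid (subst₂ Contains (flipWord-involutive w)
                         (cong₂ pattern2143 (not-involutive s) (not-involutive t))
                         (flipWord-contains-2143 occ))

proposition4p1 : ∀ (m : ℕ) → SameCard {suc m} (InB (suc m) τ₁) (InB (suc m) τ₂)
proposition4p1 _ =
  flipWord , flipWord ,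
  (λ _ (perm , avoid) → flipWord-IsSignedPerm perm , flipWord-avoids-2143 false true avoid) ,
  (λ _ (perm , avoid) → flipWord-IsSignedPerm perm , flipWord-avoids-2143 true false avoid) ,
  (λ w _ → flipWord-involutive w) ,
  (λ w _ → flipWord-involutive w)
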